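{- The problem $\Pi$ defined in the context cannot be solved in $0$ rounds in the deterministic port numbering model; that is, there is no sequence $(a_1,\dots,a_\Delta)$ of labels of $\Pi$ such that the multiset $\{a_1,\dots,a_\Delta\}$ lies in the node constraint of $\Pi$ and, for every choice of (not necessarily distinct) ports $p_1,\dots,p_r\in\{1,\dots,\Delta\}$, the multiset $\{a_{p_1},\dots,a_{p_r}\}$ lies in the hyperedge constraint of $\Pi$.
   Context: Fix integers $\Delta\ge 2$, $r\ge 2$ and let $\mathfrak{C}=\{1,\dots,\Delta\}$. The problem $\Pi$ has label set $\{\ell(\mathcal{C}):\mathcal{C}\subseteq\mathfrak{C}\}$ (one label per possibly empty color set). Its node constraint consists of the multisets $\ell(\mathcal{C})^{\Delta-|\mathcal{C}|+1}\,\ell(\emptyset)^{|\mathcal{C}|-1}$ (exponents denote multiplicities) for each nonempty $\mathcal{C}\subseteq\mathfrak{C}$. Its hyperedge constraint consists of all multisets $\ell(\mathcal{C}_1)\dots\ell(\mathcal{C}_r)$ of size $r$ such that for every color $i\in\mathfrak{C}$ there is at least one $j$ with $i\notin\mathcal{C}_j$. (In the port numbering model all degree-$\Delta$ nodes running a deterministic $0$-round algorithm output the same label on their port $p$, and nodes' ports may be attached to a common hyperedge arbitrarily; this is what the formulation in the claim expresses.) -}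

module Defs where

open import Data.Nat using (ℕ; _∸_; _+_)
open import Data.Fin using (Fin)
open import Data.Fin.Subset using (Subset; _∉_; ∣_∣; Nonempty) renaming (⊥ to ∅)
open import Data.List using (List; replicate; _++_)
open import Data.List.Relation.Unary.Any using (Any)
open import Data.List.Relation.Binary.Permutation.Propositional using (_↭_)
open import Data.Vec using (Vec; toList)
open import Data.Product using (Σ; _×_)

-- Colors are Fin Δ (standing for 1..Δ).  A label ℓ(C) is identified with the
-- color set C : Subset Δ.  Multisets are lists up to permutation (_↭_).

Label : ℕ → Set
Label Δ = Subset Δ

NodeConstraint : (Δ : ℕ) → List (Label Δ) → Set
NodeConstraint Δ xs =
  Σ (Subset Δ) λ C → Nonempty C ×
    (xs ↭ (replicate (Δ ∸ ∣ C ∣ + 1) C ++ replicate (∣ C ∣ ∸ 1) ∅))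

HyperedgeConstraint : (Δ : ℕ) → List (Label Δ) → Set
HyperedgeConstraint Δ xs = (i : Fin Δ) → Any (λ C → i ∉ C) xs

-- Some port p of a node carries the nonempty label ℓ(C) from the node
-- constraint.  Attaching all r ports of a hyperedge to port p of the same
-- node yields the multiset ℓ(C)^r, and a colour of C is missing from none of
-- its members.

module Submission where

open import Defs
open import Data.Nat using (ℕ; _≤_; _∸_; _+_)
open import Data.Nat.Properties using (+-comm)
open import Data.Fin using (Fin)
open import Data.Fin.Subset using (_∉_; ∣_∣; Nonempty)
open import Data.Vec using (Vec; toList; map; lookup; replicate)
open import Data.Vec.Properties using (lookup-map; lookup-replicate)
open import Data.Vec.Relation.Unary.Any using (Any; index)
open import Data.Vec.Relation.Unary.Any.Properties using (toList⁻; lookup-index)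
import Data.List as List
open import Data.List.Membership.Propositional using (_∈_)
open import Data.List.Relation.Unary.Any using (here)
open import Data.List.Relation.Unary.Any.Properties using (++⁺ˡ)
open import Data.List.Relation.Binary.Permutation.Propositional using (↭-sym)
open import Data.List.Relation.Binary.Permutation.Propositional.Properties using (∈-resp-↭)
open import Data.Product using (Σ; _×_; _,_)
open import Relation.Nullary using (¬_)
open import Relation.Binary.PropositionalEquality using (_≡_; refl; trans; cong; subst)

∈-replicate-+1 : ∀ {A : Set} (n : ℕ) (x : A) → x ∈ List.replicate (n + 1) x
∈-replicate-+1 n x rewrite +-comm n 1 = here refl

∈-toList⇒lookup : ∀ {A : Set} {n} {x : A} (a : Vec A n) →
  x ∈ toList a → Σ (Fin n) λ p → x ≡ lookup a p
∈-toList⇒lookup a x∈a = let w = toList⁻ x∈a in index w , lookup-index w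

nodeConstraint⇒nonempty-port : ∀ {Δ} (a : Vec (Label Δ) Δ) →
  NodeConstraint Δ (toList a) → Σ (Fin Δ) λ p → Nonempty (lookup a p)
nodeConstraint⇒nonempty-port {Δ} a (C , C≢∅ , a↭C) with
  ∈-toList⇒lookup a (∈-resp-↭ (↭-sym a↭C) (++⁺ˡ (∈-replicate-+1 (Δ ∸ ∣ C ∣) C)))
... | p , refl = p , C≢∅

¬hyperedgeConstraint-at-nonempty-port : ∀ {Δ} (r : ℕ) (a : Vec (Label Δ) Δ) (p : Fin Δ) →
  Nonempty (lookup a p) → ¬ HyperedgeConstraint Δ (toList (map (lookup a) (replicate r p)))
¬hyperedgeConstraint-at-nonempty-port r a p (i , i∈ap) hyp = i∉ap i∈ap
  where
    missing : Any (i ∉_) (map (lookup a) (replicate r p))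
    missing = toList⁻ (hyp i)

    k : Fin r
    k = index missing

    lookup-constant : lookup (map (lookup a) (replicate r p)) k ≡ lookup a p
    lookup-constant = trans (lookup-map k (lookup a) (replicate r p))
                            (cong (lookup a) (lookup-replicate k p))

    i∉ap : i ∉ lookup a p
    i∉ap = subst (i ∉_) lookup-constant (lookup-index missing)

lemma12 : (Δ r : ℕ) → 2 ≤ Δ → 2 ≤ r →
    ¬ (Σ (Vec (Label Δ) Δ) λ a →
         NodeConstraint Δ (toList a) ×
         ((p : Vec (Fin Δ) r) → HyperedgeConstraint Δ (toList (map (lookup a) p))))
lemma12 Δ r _ _ (a , node , hyperedge) with nodeConstraint⇒nonempty-port a node
... | p , nonempty = ¬hyperedgeConstraint-at-nonempty-port r a p nonempty (hyperedge (replicate r p))
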